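{- Let $r,s$ be positive integers and $k\in\mathbb{Z}$. For every integer $n\geq 0$, \[ \tilde{A}_{n}^{(r,k)}(x)=\sum_{m=0}^{n}\left\{\sum_{l=0}^{n-m}\binom{n}{l}S_{1}(n-l,m)\,\tilde{A}_{l}^{(r+s,k)}(s)\right\}B_{m}^{(s)}(x). \]
   Context: For $k\in\mathbb{Z}$ let $\mathrm{Lif}_{k}(x)=\sum_{m=0}^{\infty}\frac{x^{m}}{m!(m+1)^{k}}$. For an integer $r\geq 0$ and $k\in\mathbb{Z}$, the polynomials $\tilde{A}_{n}^{(r,k)}(x)$ are defined by \[ \left(\frac{t}{(1+t)\log(1+t)}\right)^{r}\mathrm{Lif}_{k}\bigl(-\log(1+t)\bigr)(1+t)^{x}=\sum_{n=0}^{\infty}\tilde{A}_{n}^{(r,k)}(x)\frac{t^{n}}{n!}. \] Bernoulli polynomials of order $s$ are defined by $\left(\frac{t}{e^{t}-1}\right)^{s}e^{xt}=\sum_{n\geq 0}B_{n}^{(s)}(x)\frac{t^{n}}{n!}$. $S_{1}(n,m)$ are the Stirling numbers of the first kind, defined by $x(x-1)\cdots(x-n+1)=\sum_{m=0}^{n}S_{1}(n,m)x^{m}$. -}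

module Defs where

open import Data.Nat as ℕ using (ℕ; zero; suc; _!)
open import Data.Nat.Properties using (_!≢0; m^n>0)
open import Data.Nat.Combinatorics using (_C_)
open import Data.Integer as ℤ using (ℤ; +_; -[1+_])
open import Data.Rational as ℚ using (ℚ; 0ℚ; 1ℚ; _+_; _*_; _-_; -_; _/_)
open import Data.List using (List; []; _∷_)

-- Formal power series over ℚ in the variable t, as coefficient functions.

FPS : Set
FPS = ℕ → ℚ

sumTo : ℕ → (ℕ → ℚ) → ℚ
sumTo zero    f = f 0
sumTo (suc n) f = sumTo n f + f (suc n)

fromℕ : ℕ → ℚ
fromℕ n = (+ n) / 1

powQ : ℚ → ℕ → ℚ
powQ q zero    = 1ℚ
powQ q (suc n) = q * powQ q n

invFact : ℕ → ℚ
invFact n = (+ 1) / (n !)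
  where instance _ = n !≢0

oneS : FPS
oneS zero    = 1ℚ
oneS (suc _) = 0ℚ

onePlusT : FPS
onePlusT zero          = 1ℚ
onePlusT (suc zero)    = 1ℚ
onePlusT (suc (suc _)) = 0ℚ

subS : FPS → FPS → FPS
subS f g n = f n - g n

negS : FPS → FPS
negS f n = - f n

mulS : FPS → FPS → FPS
mulS f g n = sumTo n (λ i → f i * g (n ℕ.∸ i))

powS : FPS → ℕ → FPS
powS f zero    = oneS
powS f (suc j) = mulS f (powS f j)

-- Composition Σ_j c_j u(t)^j, meaningful when u has zero constant term
-- (then only j ≤ n contribute to the coefficient of t^n).
composeS : (ℕ → ℚ) → FPS → FPS
composeS c u n = sumTo n (λ j → c j * powS u j n)

-- Reciprocal of a series with constant term 1:  1/f = Σ_j (1 - f)^j.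
recipS : FPS → FPS
recipS f = composeS (λ _ → 1ℚ) (subS oneS f)

-- log(1+t) = Σ_{n≥1} (-1)^{n-1} t^n / n
logS : FPS
logS zero    = 0ℚ
logS (suc m) = powQ (- 1ℚ) m * ((+ 1) / suc m)

-- log(1+t)/t = Σ_{n≥0} (-1)^n t^n/(n+1)
logOverT : FPS
logOverT n = powQ (- 1ℚ) n * ((+ 1) / suc n)

-- t / ((1+t) log(1+t))
baseA : FPS
baseA = recipS (mulS onePlusT logOverT)

-- Coefficient 1/(m! (m+1)^k) of Lif_k, for k ∈ ℤ
lifCoeff : ℤ → ℕ → ℚ
lifCoeff (+ a)     m = invFact m * ((+ 1) / (suc m ℕ.^ a))
  where instance _ = ℕ.>-nonZero (m^n>0 (suc m) a)
lifCoeff -[1+ a ]  m = invFact m * fromℕ (suc m ℕ.^ suc a)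

-- Lif_k(-log(1+t))
lifS : ℤ → FPS
lifS k = composeS (lifCoeff k) (negS logS)

fallingQ : ℚ → ℕ → ℚ
fallingQ x zero    = 1ℚ
fallingQ x (suc n) = fallingQ x n * (x - fromℕ n)

-- (1+t)^x = Σ_n binom(x,n) t^n
binomS : ℚ → FPS
binomS x n = fallingQ x n * invFact n

-- Ã_n^{(r,k)}(x) = n! [t^n] (t/((1+t)log(1+t)))^r Lif_k(-log(1+t)) (1+t)^x
Atilde : ℕ → ℤ → ℕ → ℚ → ℚ
Atilde r k n x = fromℕ (n !) * mulS (mulS (powS baseA r) (lifS k)) (binomS x) n

-- (e^t - 1)/t = Σ t^n/(n+1)!
expm1OverT : FPS
expm1OverT n = invFact (suc n)

expS : ℚ → FPS
expS x n = powQ x n * invFact n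

-- Bernoulli polynomials of order s: B_n^{(s)}(x) = n! [t^n] (t/(e^t-1))^s e^{xt}
bernoulli : ℕ → ℕ → ℚ → ℚ
bernoulli s n x = fromℕ (n !) * mulS (powS (recipS expm1OverT) s) (expS x) n

-- Stirling numbers of the first kind as coefficients of the falling
-- factorial x(x-1)...(x-n+1) = Σ_m S1(n,m) x^m.

-- coefficient lists (constant term first)
shiftP : List ℤ → List ℤ
shiftP p = ℤ.+ 0 ∷ p

scaleP : ℤ → List ℤ → List ℤ
scaleP c []       = []
scaleP c (a ∷ p)  = c ℤ.* a ∷ scaleP c p

addP : List ℤ → List ℤ → List ℤ
addP []       q        = q
addP (a ∷ p)  []       = a ∷ p
addP (a ∷ p)  (b ∷ q)  = (a ℤ.+ b) ∷ addP p q

fallingPoly : ℕ → List ℤ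
fallingPoly zero    = ℤ.+ 1 ∷ []
fallingPoly (suc n) = addP (shiftP (fallingPoly n)) (scaleP (ℤ.- (ℤ.+ n)) (fallingPoly n))

coeff : List ℤ → ℕ → ℤ
coeff []       _       = ℤ.+ 0
coeff (a ∷ p)  zero    = a
coeff (a ∷ p)  (suc m) = coeff p m

S1 : ℕ → ℕ → ℤ
S1 n m = coeff (fallingPoly n) m

fromℤ : ℤ → ℚ
fromℤ z = z / 1

-- Fix k, let L(t) = log(1+t), and write A_{r,x}(t) = (t/((1+t)L))^r
-- Lif_k(-L) (1+t)^x and B_{s,x}(t) = (t/(e^t-1))^s e^{xt} for the two
-- generating functions.  The proof is an identity of formal power series
-- over ℚ:
--
--   A_{r+s,s}(t) · B_{s,x}(L(t)) = A_{r,x}(t).                         (★)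
--
-- Substituting L turns e^{xt} into (1+t)^x and t/(e^t-1) into t/L(t); since
-- (1+t)^s · (t/((1+t)L))^s · (L/t)^s = 1, (★) follows by rearranging factors.
-- Reading off n! times the coefficient of t^n in (★), with the expansion
-- L(t)^m = m! Σ_n S1(n,m) t^n/n!, gives the stated double sum.
module Submission where

open import Defs
open import Data.Nat as ℕ using (ℕ; zero; suc; _!; _≤_; _<_; _∸_; z≤n; s≤s)
import Data.Nat.Properties as ℕP
open import Data.Nat.Combinatorics using (_C_; k![n∸k]!∣n!)
open import Data.Nat.Combinatorics.Specification using (nCk≡n!/k![n-k]!)
open import Data.Nat.DivMod using (m/n*n≡m)
open import Data.Integer as ℤ using (ℤ; +_)
import Data.Integer.Properties as ℤP
open import Data.Rational as ℚ using (ℚ; 0ℚ; 1ℚ; _+_; _*_; _-_; -_; _/_)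
import Data.Rational.Properties as ℚP
import Data.Rational.Unnormalised as ℚᵘ
import Data.Rational.Unnormalised.Properties as ℚᵘP
open import Data.List using ([]; _∷_)
open import Data.Vec using ([]; _∷_)
open import Data.Maybe using (Maybe; just; nothing)
open import Data.Product using (_,_)
import Data.Fin as Fin
open import Level using (0ℓ)
open import Relation.Nullary using (yes; no)
open import Relation.Binary.Bundles using (Setoid)
open import Relation.Binary.PropositionalEquality
  using (_≡_; refl; sym; trans; cong; cong₂; module ≡-Reasoning)
import Relation.Binary.Reasoning.Setoid as SetoidReasoning
open import Algebra.Bundles using (CommutativeMonoid)
import Algebra.Solver.CommutativeMonoid as CommutativeMonoidSolver
import Algebra.Properties.CommutativeMonoid.Mult as MonoidPower
open import Tactic.RingSolver using (solve-∀)
open import Tactic.RingSolver.Core.AlmostCommutativeRing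
  using (AlmostCommutativeRing; fromCommutativeRing)

ℚ-ring : AlmostCommutativeRing 0ℓ 0ℓ
ℚ-ring = fromCommutativeRing ℚP.+-*-commutativeRing isZero
  where
  isZero : (x : ℚ) → Maybe (0ℚ ≡ x)
  isZero x with 0ℚ ℚP.≟ x
  ... | yes p = just p
  ... | no _  = nothing

inverse-unique : ∀ {a ℓ} (M : CommutativeMonoid a ℓ) → let open CommutativeMonoid M in
  ∀ x y z → x ∙ y ≈ ε → x ∙ z ≈ ε → y ≈ z
inverse-unique M x y z xy xz = begin
  y             ≈⟨ identityˡ y ⟨
  ε ∙ y         ≈⟨ ∙-congʳ xz ⟨
  (x ∙ z) ∙ y   ≈⟨ assoc x z y ⟩
  x ∙ (z ∙ y)   ≈⟨ ∙-congˡ (comm z y) ⟩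
  x ∙ (y ∙ z)   ≈⟨ assoc x y z ⟨
  (x ∙ y) ∙ z   ≈⟨ ∙-congʳ xy ⟩
  ε ∙ z         ≈⟨ identityˡ z ⟩
  z             ∎
  where
  open CommutativeMonoid M using (_∙_; ε; setoid; identityˡ; assoc; comm; ∙-congˡ; ∙-congʳ)
  open SetoidReasoning setoid

-- The embeddings fromℤ z = z/1 and fromℕ n = n/1 are ring homomorphisms.
-- They are proved through the unnormalised rationals, where z/1 is literally
-- the fraction with numerator z.
toℚᵘ-fromℤ : ∀ z → ℚ.toℚᵘ (fromℤ z) ℚᵘ.≃ ℚᵘ.mkℚᵘ z 0
toℚᵘ-fromℤ z = ℚP.toℚᵘ-fromℚᵘ (ℚᵘ.mkℚᵘ z 0)

fromℤ-+ : ∀ a b → fromℤ (a ℤ.+ b) ≡ fromℤ a + fromℤ b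
fromℤ-+ a b = ℚP.toℚᵘ-injective (ℚᵘP.≃-trans (toℚᵘ-fromℤ (a ℤ.+ b))
  (ℚᵘP.≃-trans unnormalised (ℚᵘP.≃-sym (ℚᵘP.≃-trans (ℚP.toℚᵘ-homo-+ (fromℤ a) (fromℤ b))
    (ℚᵘP.+-cong (toℚᵘ-fromℤ a) (toℚᵘ-fromℤ b))))))
  where
  unnormalised : ℚᵘ.mkℚᵘ (a ℤ.+ b) 0 ℚᵘ.≃ ℚᵘ.mkℚᵘ a 0 ℚᵘ.+ ℚᵘ.mkℚᵘ b 0
  unnormalised = ℚᵘ.*≡* (cong₂ ℤ._*_ (sym (cong₂ ℤ._+_ (ℤP.*-identityʳ a) (ℤP.*-identityʳ b))) refl)

fromℤ-* : ∀ a b → fromℤ (a ℤ.* b) ≡ fromℤ a * fromℤ b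
fromℤ-* a b = ℚP.toℚᵘ-injective (ℚᵘP.≃-trans (toℚᵘ-fromℤ (a ℤ.* b))
  (ℚᵘP.≃-sym (ℚᵘP.≃-trans (ℚP.toℚᵘ-homo-* (fromℤ a) (fromℤ b))
    (ℚᵘP.*-cong (toℚᵘ-fromℤ a) (toℚᵘ-fromℤ b)))))

fromℤ-neg : ∀ a → fromℤ (ℤ.- a) ≡ - fromℤ a
fromℤ-neg a = ℚP.toℚᵘ-injective (ℚᵘP.≃-trans (toℚᵘ-fromℤ (ℤ.- a))
  (ℚᵘP.≃-sym (ℚᵘP.≃-trans (ℚP.toℚᵘ-homo‿- (fromℤ a)) (ℚᵘP.-‿cong (toℚᵘ-fromℤ a)))))

fromℕ-+ : ∀ a b → fromℕ (a ℕ.+ b) ≡ fromℕ a + fromℕ b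
fromℕ-+ a b = trans (cong fromℤ (ℤP.pos-+ a b)) (fromℤ-+ (+ a) (+ b))

fromℕ-* : ∀ a b → fromℕ (a ℕ.* b) ≡ fromℕ a * fromℕ b
fromℕ-* a b = trans (cong fromℤ (ℤP.pos-* a b)) (fromℤ-* (+ a) (+ b))

fromℕ-inverse : ∀ d .{{_ : ℕ.NonZero d}} → fromℕ d * ((+ 1) / d) ≡ 1ℚ
fromℕ-inverse (suc d) = ℚP.toℚᵘ-injective
  (ℚᵘP.≃-trans (ℚP.toℚᵘ-homo-* (fromℕ (suc d)) ((+ 1) / suc d))
  (ℚᵘP.≃-trans (ℚᵘP.*-cong (toℚᵘ-fromℤ (+ suc d)) (ℚP.toℚᵘ-fromℚᵘ (ℚᵘ.mkℚᵘ (+ 1) d)))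
  (ℚᵘ.*≡* (cong +_ cross-multiplied))))
  where
  cross-multiplied : (suc d ℕ.* 1) ℕ.* 1 ≡ 1 ℕ.* (1 ℕ.* suc d)
  cross-multiplied = trans (ℕP.*-identityʳ _) (trans (ℕP.*-identityʳ _)
    (sym (trans (ℕP.*-identityˡ _) (ℕP.*-identityˡ _))))

fromℕ-suc-cancel : ∀ d {x y} → fromℕ (suc d) * x ≡ fromℕ (suc d) * y → x ≡ y
fromℕ-suc-cancel d {x} {y} eq = trans (sym (undo x)) (trans (cong (inv *_) eq) (undo y))
  where
  inv : ℚ
  inv = (+ 1) / suc d
  undo : ∀ z → inv * (fromℕ (suc d) * z) ≡ z
  undo z = trans (sym (ℚP.*-assoc inv (fromℕ (suc d)) z))
    (trans (cong (_* z) (trans (ℚP.*-comm inv (fromℕ (suc d))) (fromℕ-inverse (suc d))))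
      (ℚP.*-identityˡ z))

fromℕ-fact : ∀ n → fromℕ (n !) * invFact n ≡ 1ℚ
fromℕ-fact n = fromℕ-inverse (n !) {{n ℕP.!≢0}}

invFact-suc : ∀ n → fromℕ (suc n) * invFact (suc n) ≡ invFact n
invFact-suc n = inverse-unique ℚP.*-1-commutativeMonoid (fromℕ (n !)) _ _ n!-inverse (fromℕ-fact n)
  where
  open ≡-Reasoning
  n!-inverse : fromℕ (n !) * (fromℕ (suc n) * invFact (suc n)) ≡ 1ℚ
  n!-inverse = begin
    fromℕ (n !) * (fromℕ (suc n) * invFact (suc n)) ≡⟨ ℚP.*-assoc (fromℕ (n !)) _ _ ⟨
    (fromℕ (n !) * fromℕ (suc n)) * invFact (suc n) ≡⟨ cong (_* invFact (suc n)) (ℚP.*-comm (fromℕ (n !)) _) ⟩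
    (fromℕ (suc n) * fromℕ (n !)) * invFact (suc n) ≡⟨ cong (_* invFact (suc n)) (fromℕ-* (suc n) (n !)) ⟨
    fromℕ (suc n !) * invFact (suc n)              ≡⟨ fromℕ-fact (suc n) ⟩
    1ℚ                                              ∎

binomial-factorial : ∀ n l → l ≤ n → fromℕ (n C l) * fromℕ (l !) ≡ fromℕ (n !) * invFact (n ∸ l)
binomial-factorial n l l≤n = begin
  B * L                   ≡⟨ ℚP.*-identityʳ (B * L) ⟨
  B * L * 1ℚ              ≡⟨ cong (B * L *_) (fromℕ-fact (n ∸ l)) ⟨
  B * L * (D * I)         ≡⟨ regroup B L D I ⟩
  (B * (L * D)) * I       ≡⟨ cong (λ z → (B * z) * I) (fromℕ-* (l !) ((n ∸ l) !)) ⟨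
  (B * fromℕ (l ! ℕ.* (n ∸ l) !)) * I ≡⟨ cong (_* I) (fromℕ-* (n C l) _) ⟨
  fromℕ ((n C l) ℕ.* (l ! ℕ.* (n ∸ l) !)) * I ≡⟨ cong (λ z → fromℕ z * I) n!-factorisation ⟩
  fromℕ (n !) * I         ∎
  where
  open ≡-Reasoning
  B L D I : ℚ
  B = fromℕ (n C l)
  L = fromℕ (l !)
  D = fromℕ ((n ∸ l) !)
  I = invFact (n ∸ l)
  regroup : ∀ B L D I → B * L * (D * I) ≡ (B * (L * D)) * I
  regroup = solve-∀ ℚ-ring
  n!-factorisation : (n C l) ℕ.* (l ! ℕ.* (n ∸ l) !) ≡ n !
  n!-factorisation = trans (cong (ℕ._* (l ! ℕ.* (n ∸ l) !)) (nCk≡n!/k![n-k]! l≤n))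
                           (m/n*n≡m (k![n∸k]!∣n! l≤n))
    where instance _ = l ℕP.!* (n ∸ l) !≢0

sumTo-cong : ∀ n {f g : ℕ → ℚ} → (∀ i → i ≤ n → f i ≡ g i) → sumTo n f ≡ sumTo n g
sumTo-cong zero    eq = eq 0 z≤n
sumTo-cong (suc n) eq = cong₂ _+_ (sumTo-cong n (λ i i≤n → eq i (ℕP.m≤n⇒m≤1+n i≤n))) (eq (suc n) ℕP.≤-refl)

sumTo-cong′ : ∀ n {f g : ℕ → ℚ} → (∀ i → f i ≡ g i) → sumTo n f ≡ sumTo n g
sumTo-cong′ n eq = sumTo-cong n (λ i _ → eq i)

sumTo-+ : ∀ n (f g : ℕ → ℚ) → sumTo n (λ i → f i + g i) ≡ sumTo n f + sumTo n g
sumTo-+ zero    f g = refl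
sumTo-+ (suc n) f g = trans (cong (_+ (f (suc n) + g (suc n))) (sumTo-+ n f g))
  (interchange (sumTo n f) (sumTo n g) (f (suc n)) (g (suc n)))
  where
  interchange : (a b c d : ℚ) → (a + b) + (c + d) ≡ (a + c) + (b + d)
  interchange = solve-∀ ℚ-ring

sumTo-*ˡ : ∀ n c (f : ℕ → ℚ) → c * sumTo n f ≡ sumTo n (λ i → c * f i)
sumTo-*ˡ zero    c f = refl
sumTo-*ˡ (suc n) c f = trans (ℚP.*-distribˡ-+ c (sumTo n f) (f (suc n)))
  (cong (_+ (c * f (suc n))) (sumTo-*ˡ n c f))

sumTo-*ʳ : ∀ n c (f : ℕ → ℚ) → sumTo n f * c ≡ sumTo n (λ i → f i * c)
sumTo-*ʳ n c f = trans (ℚP.*-comm _ c) (trans (sumTo-*ˡ n c f) (sumTo-cong′ n (λ i → ℚP.*-comm c (f i))))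

sumTo-neg : ∀ n (f : ℕ → ℚ) → - sumTo n f ≡ sumTo n (λ i → - f i)
sumTo-neg zero    f = refl
sumTo-neg (suc n) f = trans (ℚP.neg-distrib-+ (sumTo n f) (f (suc n))) (cong (_+ (- f (suc n))) (sumTo-neg n f))

sumTo-- : ∀ n (f g : ℕ → ℚ) → sumTo n (λ i → f i - g i) ≡ sumTo n f - sumTo n g
sumTo-- n f g = trans (sumTo-+ n f (λ i → - g i)) (cong (λ z → sumTo n f + z) (sym (sumTo-neg n g)))

sumTo-zero : ∀ n {f : ℕ → ℚ} → (∀ i → i ≤ n → f i ≡ 0ℚ) → sumTo n f ≡ 0ℚ
sumTo-zero n eq = trans (sumTo-cong n eq) (sumTo-zeros n)
  where
  sumTo-zeros : ∀ n → sumTo n (λ _ → 0ℚ) ≡ 0ℚ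
  sumTo-zeros zero    = refl
  sumTo-zeros (suc n) = cong (_+ 0ℚ) (sumTo-zeros n)

sumTo-extend : ∀ {n m} {f : ℕ → ℚ} → n ≤ m → (∀ i → n < i → f i ≡ 0ℚ) → sumTo m f ≡ sumTo n f
sumTo-extend {n} {m} {f} n≤m vanish =
  trans (cong (λ z → sumTo z f) (sym (ℕP.m∸n+n≡m n≤m))) (extend (m ∸ n))
  where
  extend : ∀ k → sumTo (k ℕ.+ n) f ≡ sumTo n f
  extend zero    = refl
  extend (suc k) = trans (cong₂ _+_ (extend k) (vanish (suc (k ℕ.+ n)) (s≤s (ℕP.m≤n+m n k))))
                         (ℚP.+-identityʳ _)

sumTo-shift : ∀ n (f : ℕ → ℚ) → sumTo (suc n) f ≡ f 0 + sumTo n (λ i → f (suc i))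
sumTo-shift zero    f = refl
sumTo-shift (suc n) f = trans (cong (_+ f (suc (suc n))) (sumTo-shift n f)) (ℚP.+-assoc (f 0) _ _)

sumTo-reverse : ∀ n (f : ℕ → ℚ) → sumTo n f ≡ sumTo n (λ i → f (n ∸ i))
sumTo-reverse zero    f = refl
sumTo-reverse (suc n) f = sym (begin
  sumTo (suc n) (λ i → f (suc n ∸ i)) ≡⟨ sumTo-shift n (λ i → f (suc n ∸ i)) ⟩
  f (suc n) + sumTo n (λ i → f (n ∸ i)) ≡⟨ cong (λ z → f (suc n) + z) (sumTo-reverse n f) ⟨
  f (suc n) + sumTo n f                 ≡⟨ ℚP.+-comm (f (suc n)) (sumTo n f) ⟩
  sumTo (suc n) f                       ∎)
  where open ≡-Reasoning

sumTo-swap : ∀ n m (g : ℕ → ℕ → ℚ) →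
  sumTo n (λ i → sumTo m (λ j → g i j)) ≡ sumTo m (λ j → sumTo n (λ i → g i j))
sumTo-swap zero    m g = refl
sumTo-swap (suc n) m g = trans (cong (_+ sumTo m (g (suc n))) (sumTo-swap n m g))
  (sym (sumTo-+ m (λ j → sumTo n (λ i → g i j)) (g (suc n))))

-- Σ_{p ≤ n} Σ_{i ≤ p} G(i, p-i) = Σ_{i ≤ n} Σ_{j ≤ n-i} G(i, j):
-- both run over the pairs (i, j) with i + j ≤ n.
sumTo-triangle : ∀ n (G : ℕ → ℕ → ℚ) →
  sumTo n (λ p → sumTo p (λ i → G i (p ∸ i))) ≡ sumTo n (λ i → sumTo (n ∸ i) (λ j → G i j))
sumTo-triangle zero    G = refl
sumTo-triangle (suc n) G = begin
  sumTo n (λ p → sumTo p (λ i → G i (p ∸ i))) + sumTo (suc n) (λ i → G i (suc n ∸ i))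
    ≡⟨ cong (_+ sumTo (suc n) (λ i → G i (suc n ∸ i))) (sumTo-triangle n G) ⟩
  T + (sumTo n (λ i → G i (suc n ∸ i)) + G (suc n) (n ∸ n))
    ≡⟨ ℚP.+-assoc T _ _ ⟨
  (T + sumTo n (λ i → G i (suc n ∸ i))) + G (suc n) (n ∸ n)
    ≡⟨ cong₂ _+_ (sym (sumTo-+ n _ _)) (cong (G (suc n)) (ℕP.n∸n≡0 n)) ⟩
  sumTo n (λ i → sumTo (n ∸ i) (G i) + G i (suc n ∸ i)) + G (suc n) 0
    ≡⟨ cong₂ _+_ (sumTo-cong n row) (cong (λ z → sumTo z (G (suc n))) (sym (ℕP.n∸n≡0 n))) ⟩
  sumTo (suc n) (λ i → sumTo (suc n ∸ i) (G i)) ∎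
  where
  open ≡-Reasoning
  T : ℚ
  T = sumTo n (λ i → sumTo (n ∸ i) (λ j → G i j))
  row : ∀ i → i ≤ n → sumTo (n ∸ i) (G i) + G i (suc n ∸ i) ≡ sumTo (suc n ∸ i) (G i)
  row i i≤n rewrite ℕP.+-∸-assoc 1 i≤n = refl

sumTo-triangle-swap : ∀ n (g : ℕ → ℕ → ℚ) →
  sumTo n (λ i → sumTo (n ∸ i) (λ j → g i j)) ≡ sumTo n (λ j → sumTo (n ∸ j) (λ i → g i j))
sumTo-triangle-swap n g = begin
  sumTo n (λ i → sumTo (n ∸ i) (λ j → g i j)) ≡⟨ sumTo-triangle n g ⟨
  sumTo n (λ p → sumTo p (λ i → g i (p ∸ i))) ≡⟨ sumTo-cong′ n reverse-inner ⟩
  sumTo n (λ p → sumTo p (λ j → g (p ∸ j) j)) ≡⟨ sumTo-triangle n (λ j i → g i j) ⟩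
  sumTo n (λ j → sumTo (n ∸ j) (λ i → g i j)) ∎
  where
  open ≡-Reasoning
  reverse-inner : ∀ p → sumTo p (λ i → g i (p ∸ i)) ≡ sumTo p (λ j → g (p ∸ j) j)
  reverse-inner p = trans (sumTo-reverse p _)
    (sumTo-cong p (λ j j≤p → cong (g (p ∸ j)) (ℕP.m∸[m∸n]≡n j≤p)))

telescope : ∀ N (a : ℕ → ℚ) → sumTo N (λ j → a j - a (suc j)) ≡ a 0 - a (suc N)
telescope zero    a = refl
telescope (suc N) a = trans (cong (_+ (a (suc N) - a (suc (suc N)))) (telescope N a))
  (collapse (a 0) (a (suc N)) (a (suc (suc N))))
  where
  collapse : ∀ (x y z : ℚ) → (x - y) + (y - z) ≡ x - z
  collapse = solve-∀ ℚ-ring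

sumTo-oneS : ∀ n (h : ℕ → ℚ) → sumTo n (λ i → oneS i * h i) ≡ h 0
sumTo-oneS zero    h = ℚP.*-identityˡ (h 0)
sumTo-oneS (suc n) h = trans (cong₂ _+_ (sumTo-oneS n h) (ℚP.*-zeroˡ (h (suc n)))) (ℚP.+-identityʳ (h 0))

infix 4 _≈_
_≈_ : FPS → FPS → Set
f ≈ g = ∀ n → f n ≡ g n

≈-setoid : Setoid 0ℓ 0ℓ
≈-setoid = record
  { Carrier       = FPS
  ; _≈_           = _≈_
  ; isEquivalence = record
    { refl  = λ n → refl
    ; sym   = λ f≈g n → sym (f≈g n)
    ; trans = λ f≈g g≈h n → trans (f≈g n) (g≈h n)
    }
  }

open Setoid ≈-setoid using () renaming (refl to ≈-refl; sym to ≈-sym; trans to ≈-trans)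

addS : FPS → FPS → FPS
addS f g n = f n + g n

scaleS : ℚ → FPS → FPS
scaleS c f n = c * f n

addS-cong : ∀ {f f′ g g′} → f ≈ f′ → g ≈ g′ → addS f g ≈ addS f′ g′
addS-cong f≈f′ g≈g′ n = cong₂ _+_ (f≈f′ n) (g≈g′ n)

scaleS-cong : ∀ c {f g} → f ≈ g → scaleS c f ≈ scaleS c g
scaleS-cong c f≈g n = cong (c *_) (f≈g n)

scaleS-scaleS : ∀ a b f → scaleS a (scaleS b f) ≈ scaleS (a * b) f
scaleS-scaleS a b f n = sym (ℚP.*-assoc a b (f n))

tS : FPS
tS zero          = 0ℚ
tS (suc zero)    = 1ℚ
tS (suc (suc _)) = 0ℚ

mulS-cong : ∀ {f f′ g g′} → f ≈ f′ → g ≈ g′ → mulS f g ≈ mulS f′ g′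
mulS-cong f≈f′ g≈g′ n = sumTo-cong′ n (λ i → cong₂ _*_ (f≈f′ i) (g≈g′ (n ∸ i)))

mulS-comm : ∀ f g → mulS f g ≈ mulS g f
mulS-comm f g n = trans (sumTo-reverse n (λ i → f i * g (n ∸ i)))
  (sumTo-cong n (λ i i≤n → trans (cong (λ j → f (n ∸ i) * g j) (ℕP.m∸[m∸n]≡n i≤n))
                                 (ℚP.*-comm (f (n ∸ i)) (g i))))

mulS-assoc : ∀ f g h → mulS (mulS f g) h ≈ mulS f (mulS g h)
mulS-assoc f g h n = begin
  sumTo n (λ p → sumTo p (λ i → f i * g (p ∸ i)) * h (n ∸ p))
    ≡⟨ sumTo-cong′ n (λ p → sumTo-*ʳ p (h (n ∸ p)) (λ i → f i * g (p ∸ i))) ⟩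
  sumTo n (λ p → sumTo p (λ i → f i * g (p ∸ i) * h (n ∸ p)))
    ≡⟨ sumTo-cong′ n (λ p → sumTo-cong p (λ i i≤p →
         cong (λ q → f i * g (p ∸ i) * h (n ∸ q)) (sym (ℕP.m+[n∸m]≡n i≤p)))) ⟩
  sumTo n (λ p → sumTo p (λ i → G i (p ∸ i)))
    ≡⟨ sumTo-triangle n G ⟩
  sumTo n (λ i → sumTo (n ∸ i) (λ j → G i j))
    ≡⟨ sumTo-cong′ n (λ i → trans (sumTo-cong′ (n ∸ i) (reassociate i)) (sym (sumTo-*ˡ (n ∸ i) (f i) _))) ⟩
  mulS f (mulS g h) n ∎
  where
  open ≡-Reasoning
  G : ℕ → ℕ → ℚ
  G i j = f i * g j * h (n ∸ (i ℕ.+ j))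
  reassociate : ∀ i j → G i j ≡ f i * (g j * h (n ∸ i ∸ j))
  reassociate i j = trans (ℚP.*-assoc (f i) (g j) _) (cong (λ q → f i * (g j * h q)) (sym (ℕP.∸-+-assoc n i j)))

mulS-oneˡ : ∀ f → mulS oneS f ≈ f
mulS-oneˡ f zero    = ℚP.*-identityˡ (f 0)
mulS-oneˡ f (suc n) = sumTo-oneS (suc n) (λ i → f (suc n ∸ i))

mulS-oneʳ : ∀ f → mulS f oneS ≈ f
mulS-oneʳ f = ≈-trans (mulS-comm f oneS) (mulS-oneˡ f)

FPS-monoid : CommutativeMonoid 0ℓ 0ℓ
FPS-monoid = record
  { Carrier = FPS ; _≈_ = _≈_ ; _∙_ = mulS ; ε = oneS
  ; isCommutativeMonoid = record
    { isMonoid = record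
      { isSemigroup = record
        { isMagma = record
          { isEquivalence = Setoid.isEquivalence ≈-setoid
          ; ∙-cong        = mulS-cong }
        ; assoc = mulS-assoc }
      ; identity = mulS-oneˡ , mulS-oneʳ }
    ; comm = mulS-comm } }

mulS-distribʳ : ∀ f g h → mulS (addS f g) h ≈ addS (mulS f h) (mulS g h)
mulS-distribʳ f g h n = trans (sumTo-cong′ n (λ i → ℚP.*-distribʳ-+ (h (n ∸ i)) (f i) (g i))) (sumTo-+ n _ _)

mulS-subʳ : ∀ f g h → mulS (subS f g) h ≈ subS (mulS f h) (mulS g h)
mulS-subʳ f g h n = trans (sumTo-cong′ n (λ i → distrib (f i) (g i) (h (n ∸ i)))) (sumTo-- n _ _)
  where
  distrib : ∀ (a b c : ℚ) → (a - b) * c ≡ a * c - b * c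
  distrib = solve-∀ ℚ-ring

mulS-scaleˡ : ∀ c f g → mulS (scaleS c f) g ≈ scaleS c (mulS f g)
mulS-scaleˡ c f g n = trans (sumTo-cong′ n (λ i → ℚP.*-assoc c (f i) (g (n ∸ i)))) (sym (sumTo-*ˡ n c _))

mulS-scaleʳ : ∀ c f g → mulS f (scaleS c g) ≈ scaleS c (mulS f g)
mulS-scaleʳ c f g n = trans (mulS-comm f (scaleS c g) n) (trans (mulS-scaleˡ c g f n) (cong (c *_) (mulS-comm g f n)))

tS-suc : ∀ i → tS (suc i) ≡ oneS i
tS-suc zero    = refl
tS-suc (suc i) = refl

mulS-t-zero : ∀ g → mulS tS g 0 ≡ 0ℚ
mulS-t-zero g = ℚP.*-zeroˡ (g 0)

mulS-t-suc : ∀ g n → mulS tS g (suc n) ≡ g n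
mulS-t-suc g n = begin
  mulS tS g (suc n)                                        ≡⟨ sumTo-shift n (λ i → tS i * g (suc n ∸ i)) ⟩
  0ℚ * g (suc n) + sumTo n (λ i → tS (suc i) * g (n ∸ i))  ≡⟨ cong₂ _+_ (ℚP.*-zeroˡ (g (suc n)))
                                                                (sumTo-cong′ n (λ i → cong (_* g (n ∸ i)) (tS-suc i))) ⟩
  0ℚ + sumTo n (λ i → oneS i * g (n ∸ i))                  ≡⟨ cong (λ z → 0ℚ + z) (sumTo-oneS n (λ i → g (n ∸ i))) ⟩
  0ℚ + g n                                                 ≡⟨ ℚP.+-identityˡ (g n) ⟩
  g n                                                      ∎
  where open ≡-Reasoning

mulS-t-cancel : ∀ {f g} → mulS tS f ≈ mulS tS g → f ≈ g
mulS-t-cancel {f} {g} tf≈tg n = trans (sym (mulS-t-suc f n)) (trans (tf≈tg (suc n)) (mulS-t-suc g n))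

onePlusT-split : onePlusT ≈ addS oneS tS
onePlusT-split zero          = refl
onePlusT-split (suc zero)    = refl
onePlusT-split (suc (suc n)) = refl

mulS-onePlusT-zero : ∀ g → mulS onePlusT g 0 ≡ g 0
mulS-onePlusT-zero g = begin
  mulS onePlusT g 0                ≡⟨ mulS-cong onePlusT-split (≈-refl {g}) 0 ⟩
  mulS (addS oneS tS) g 0          ≡⟨ mulS-distribʳ oneS tS g 0 ⟩
  mulS oneS g 0 + mulS tS g 0      ≡⟨ cong₂ _+_ (mulS-oneˡ g 0) (mulS-t-zero g) ⟩
  g 0 + 0ℚ                         ≡⟨ ℚP.+-identityʳ (g 0) ⟩
  g 0                              ∎
  where open ≡-Reasoning

mulS-onePlusT-suc : ∀ g n → mulS onePlusT g (suc n) ≡ g (suc n) + g n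
mulS-onePlusT-suc g n = begin
  mulS onePlusT g (suc n)                    ≡⟨ mulS-cong onePlusT-split (≈-refl {g}) (suc n) ⟩
  mulS (addS oneS tS) g (suc n)              ≡⟨ mulS-distribʳ oneS tS g (suc n) ⟩
  mulS oneS g (suc n) + mulS tS g (suc n)    ≡⟨ cong₂ _+_ (mulS-oneˡ g (suc n)) (mulS-t-suc g n) ⟩
  g (suc n) + g n                            ∎
  where open ≡-Reasoning

-- Powers.  powS f n is the n-th power of f in FPS-monoid, so the library's
-- laws for monoid powers apply once the two definitions are identified.

open MonoidPower FPS-monoid using (_×_; ×-congʳ; ×-homo-+; ×-distrib-+)

powS≈× : ∀ f n → powS f n ≈ n × f
powS≈× f zero    = ≈-refl
powS≈× f (suc n) = mulS-cong (≈-refl {f}) (powS≈× f n)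

powS-cong : ∀ {f g} → f ≈ g → ∀ n → powS f n ≈ powS g n
powS-cong {f} {g} f≈g n = begin
  powS f n ≈⟨ powS≈× f n ⟩
  n × f    ≈⟨ ×-congʳ n f≈g ⟩
  n × g    ≈⟨ powS≈× g n ⟨
  powS g n ∎
  where open SetoidReasoning ≈-setoid

powS-+ : ∀ f a b → powS f (a ℕ.+ b) ≈ mulS (powS f a) (powS f b)
powS-+ f a b = begin
  powS f (a ℕ.+ b)           ≈⟨ powS≈× f (a ℕ.+ b) ⟩
  (a ℕ.+ b) × f              ≈⟨ ×-homo-+ f a b ⟩
  mulS (a × f) (b × f)       ≈⟨ mulS-cong (powS≈× f a) (powS≈× f b) ⟨
  mulS (powS f a) (powS f b) ∎
  where open SetoidReasoning ≈-setoid

powS-mulS : ∀ f g n → powS (mulS f g) n ≈ mulS (powS f n) (powS g n)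
powS-mulS f g n = begin
  powS (mulS f g) n          ≈⟨ powS≈× (mulS f g) n ⟩
  n × mulS f g               ≈⟨ ×-distrib-+ f g n ⟩
  mulS (n × f) (n × g)       ≈⟨ mulS-cong (powS≈× f n) (powS≈× g n) ⟨
  mulS (powS f n) (powS g n) ∎
  where open SetoidReasoning ≈-setoid

powS-oneS : ∀ n → powS oneS n ≈ oneS
powS-oneS zero    = ≈-refl
powS-oneS (suc n) = ≈-trans (mulS-oneˡ (powS oneS n)) (powS-oneS n)

powS-vanish : ∀ {u} → u 0 ≡ 0ℚ → ∀ j n → n < j → powS u j n ≡ 0ℚ
powS-vanish {u} u₀ (suc j) n n<1+j = sumTo-zero n term
  where
  term : ∀ i → i ≤ n → u i * powS u j (n ∸ i) ≡ 0ℚ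
  term zero    _     = trans (cong (_* powS u j n) u₀) (ℚP.*-zeroˡ (powS u j n))
  term (suc i) 1+i≤n = trans (cong (u (suc i) *_) (powS-vanish u₀ j (n ∸ suc i) (lower n 1+i≤n n<1+j)))
                             (ℚP.*-zeroʳ (u (suc i)))
    where
    lower : ∀ n → suc i ≤ n → n < suc j → n ∸ suc i < j
    lower (suc n) _ (s≤s n<j) = ℕP.≤-<-trans (ℕP.m∸n≤m n i) n<j

-- Reciprocals.  For f with f_0 = 1, recipS f = Σ_j (1 - f)^j is an inverse
-- of f: the product telescopes to 1 - (1 - f)^{n+1} in degree n.
recipS-inverse : ∀ f → f 0 ≡ 1ℚ → mulS f (recipS f) ≈ oneS
recipS-inverse f f₀ n = begin
  sumTo n (λ i → f i * recipS f (n ∸ i))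
    ≡⟨ sumTo-cong n (λ i i≤n → cong (f i *_) (recipS-truncated (n ∸ i) (ℕP.m∸n≤m n i))) ⟩
  sumTo n (λ i → f i * sumTo n (λ j → powS u j (n ∸ i)))
    ≡⟨ sumTo-cong′ n (λ i → sumTo-*ˡ n (f i) _) ⟩
  sumTo n (λ i → sumTo n (λ j → f i * powS u j (n ∸ i)))
    ≡⟨ sumTo-swap n n _ ⟩
  sumTo n (λ j → mulS f (powS u j) n)
    ≡⟨ sumTo-cong′ n (λ j → consecutive-powers j n) ⟩
  sumTo n (λ j → powS u j n - powS u (suc j) n)
    ≡⟨ telescope n (λ j → powS u j n) ⟩
  oneS n - powS u (suc n) n
    ≡⟨ cong (λ z → oneS n - z) (powS-vanish {u} u₀ (suc n) n ℕP.≤-refl) ⟩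
  oneS n - 0ℚ
    ≡⟨ ℚP.+-identityʳ (oneS n) ⟩
  oneS n ∎
  where
  open ≡-Reasoning
  u : FPS
  u = subS oneS f
  u₀ : u 0 ≡ 0ℚ
  u₀ = trans (cong (λ z → 1ℚ - z) f₀) (ℚP.+-inverseʳ 1ℚ)
  f≈1-u : f ≈ subS oneS u
  f≈1-u i = back (oneS i) (f i)
    where
    back : ∀ (a b : ℚ) → b ≡ a - (a - b)
    back = solve-∀ ℚ-ring
  -- f u^j = (1 - u) u^j = u^j - u^{j+1}
  consecutive-powers : ∀ j → mulS f (powS u j) ≈ subS (powS u j) (powS u (suc j))
  consecutive-powers j m = trans (mulS-cong f≈1-u (≈-refl {powS u j}) m)
    (trans (mulS-subʳ oneS u (powS u j) m) (cong (_- mulS u (powS u j) m) (mulS-oneˡ (powS u j) m)))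
  recipS-truncated : ∀ m → m ≤ n → recipS f m ≡ sumTo n (λ j → powS u j m)
  recipS-truncated m m≤n = trans (sumTo-cong′ m (λ j → ℚP.*-identityˡ (powS u j m)))
    (sym (sumTo-extend m≤n (λ j m<j → powS-vanish {u} u₀ j m m<j)))

composeS-truncate : ∀ c {u} → u 0 ≡ 0ℚ → ∀ {n N} → n ≤ N →
  composeS c u n ≡ sumTo N (λ j → c j * powS u j n)
composeS-truncate c {u} u₀ {n} n≤N = sym (sumTo-extend n≤N (λ j n<j →
  trans (cong (c j *_) (powS-vanish {u} u₀ j n n<j)) (ℚP.*-zeroʳ (c j))))

composeS-congˡ : ∀ {c c′} u → c ≈ c′ → composeS c u ≈ composeS c′ u
composeS-congˡ u c≈c′ n = sumTo-cong′ n (λ j → cong (_* powS u j n) (c≈c′ j))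

composeS-sub : ∀ a b u → composeS (subS a b) u ≈ subS (composeS a u) (composeS b u)
composeS-sub a b u n = trans (sumTo-cong′ n (λ j → distrib (a j) (b j) (powS u j n))) (sumTo-- n _ _)
  where
  distrib : ∀ (a b c : ℚ) → (a - b) * c ≡ a * c - b * c
  distrib = solve-∀ ℚ-ring

composeS-oneS : ∀ u → composeS oneS u ≈ oneS
composeS-oneS u n = sumTo-oneS n (λ j → powS u j n)

composeS-tS : ∀ u → u 0 ≡ 0ℚ → composeS tS u ≈ u
composeS-tS u u₀ zero    = trans (ℚP.*-zeroˡ (powS u 0 0)) (sym u₀)
composeS-tS u u₀ (suc n) = begin
  composeS tS u (suc n)
    ≡⟨ sumTo-shift n (λ j → tS j * powS u j (suc n)) ⟩
  0ℚ * powS u 0 (suc n) + sumTo n (λ i → tS (suc i) * powS u (suc i) (suc n))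
    ≡⟨ cong₂ _+_ (ℚP.*-zeroˡ (powS u 0 (suc n)))
                 (trans (sumTo-cong′ n (λ i → cong (_* powS u (suc i) (suc n)) (tS-suc i)))
                        (sumTo-oneS n (λ i → powS u (suc i) (suc n)))) ⟩
  0ℚ + mulS u oneS (suc n)
    ≡⟨ ℚP.+-identityˡ _ ⟩
  mulS u oneS (suc n)
    ≡⟨ mulS-oneʳ u (suc n) ⟩
  u (suc n) ∎
  where open ≡-Reasoning

composeS-mulS : ∀ a b u → u 0 ≡ 0ℚ → composeS (mulS a b) u ≈ mulS (composeS a u) (composeS b u)
composeS-mulS a b u u₀ n = begin
  sumTo n (λ j → mulS a b j * powS u j n)
    ≡⟨ sumTo-cong′ n (λ j → sumTo-*ʳ j (powS u j n) _) ⟩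
  sumTo n (λ j → sumTo j (λ i → a i * b (j ∸ i) * powS u j n))
    ≡⟨ sumTo-cong′ n (λ j → sumTo-cong j (λ i i≤j → cong (a i * b (j ∸ i) *_) (split-power i≤j))) ⟩
  sumTo n (λ j → sumTo j (λ i → H i (j ∸ i)))
    ≡⟨ sumTo-triangle n H ⟩
  sumTo n (λ i → sumTo (n ∸ i) (H i))
    ≡⟨ sumTo-cong′ n (λ i → sym (sumTo-extend (ℕP.m∸n≤m n i) (H-vanish i))) ⟩
  sumTo n (λ i → sumTo n (H i))
    ≡⟨ sumTo-cong′ n (λ i → sumTo-cong′ n (λ k → expand-product i k)) ⟩
  sumTo n (λ i → sumTo n (λ k → sumTo n (λ p → P i p * Q k p)))
    ≡⟨ sumTo-cong′ n (λ i → sumTo-swap n n _) ⟩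
  sumTo n (λ i → sumTo n (λ p → sumTo n (λ k → P i p * Q k p)))
    ≡⟨ sumTo-swap n n _ ⟩
  sumTo n (λ p → sumTo n (λ i → sumTo n (λ k → P i p * Q k p)))
    ≡⟨ sumTo-cong′ n (λ p → trans (sumTo-cong′ n (λ i → sym (sumTo-*ˡ n (P i p) _))) (sym (sumTo-*ʳ n _ _))) ⟩
  sumTo n (λ p → sumTo n (λ i → P i p) * sumTo n (λ k → Q k p))
    ≡⟨ sumTo-cong n (λ p p≤n → sym (cong₂ _*_ (composeS-truncate a u₀ p≤n)
                                              (composeS-truncate b u₀ (ℕP.m∸n≤m n p)))) ⟩
  mulS (composeS a u) (composeS b u) n ∎
  where
  open ≡-Reasoning
  H : ℕ → ℕ → ℚ
  H i k = a i * b k * mulS (powS u i) (powS u k) n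
  P Q : ℕ → ℕ → ℚ
  P i p = a i * powS u i p
  Q k p = b k * powS u k (n ∸ p)
  split-power : ∀ {i j} → i ≤ j → powS u j n ≡ mulS (powS u i) (powS u (j ∸ i)) n
  split-power {i} i≤j = trans (cong (λ z → powS u z n) (sym (ℕP.m+[n∸m]≡n i≤j))) (powS-+ u i _ n)
  H-vanish : ∀ i k → n ∸ i < k → H i k ≡ 0ℚ
  H-vanish i k n∸i<k = trans (cong (a i * b k *_) (trans (sym (powS-+ u i k n))
      (powS-vanish {u} u₀ (i ℕ.+ k) n (below n i n∸i<k))))
    (ℚP.*-zeroʳ (a i * b k))
    where
    below : ∀ m i → m ∸ i < k → m < i ℕ.+ k
    below m       zero    lt = lt
    below zero    (suc i) _  = s≤s z≤n
    below (suc m) (suc i) lt = s≤s (below m i lt)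
  expand-product : ∀ i k → H i k ≡ sumTo n (λ p → P i p * Q k p)
  expand-product i k = trans (sumTo-*ˡ n (a i * b k) _) (sumTo-cong′ n (λ p → rearrange (a i) _ (b k) _))
    where
    rearrange : ∀ (a x b y : ℚ) → a * b * (x * y) ≡ (a * x) * (b * y)
    rearrange = solve-∀ ℚ-ring

composeS-powS : ∀ c u → u 0 ≡ 0ℚ → ∀ s → composeS (powS c s) u ≈ powS (composeS c u) s
composeS-powS c u u₀ zero    = composeS-oneS u
composeS-powS c u u₀ (suc s) = ≈-trans (composeS-mulS c (powS c s) u u₀)
  (mulS-cong (≈-refl {composeS c u}) (composeS-powS c u u₀ s))

DS : FPS → FPS
DS f n = fromℕ (suc n) * f (suc n)

DS-cong : ∀ {f g} → f ≈ g → DS f ≈ DS g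
DS-cong f≈g n = cong (fromℕ (suc n) *_) (f≈g (suc n))

DS-scale : ∀ c f → DS (scaleS c f) ≈ scaleS c (DS f)
DS-scale c f n = commute (fromℕ (suc n)) c (f (suc n))
  where
  commute : ∀ (a b c : ℚ) → a * (b * c) ≡ b * (a * c)
  commute = solve-∀ ℚ-ring

DS-unique : ∀ {f g} → DS f ≈ DS g → f 0 ≡ g 0 → f ≈ g
DS-unique Df≈Dg f₀≡g₀ zero    = f₀≡g₀
DS-unique Df≈Dg f₀≡g₀ (suc n) = fromℕ-suc-cancel n (Df≈Dg n)

DS-leibniz : ∀ f g → DS (mulS f g) ≈ addS (mulS (DS f) g) (mulS f (DS g))
DS-leibniz f g n = begin
  fromℕ (suc n) * sumTo (suc n) t
    ≡⟨ sumTo-*ˡ (suc n) (fromℕ (suc n)) t ⟩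
  sumTo (suc n) (λ i → fromℕ (suc n) * t i)
    ≡⟨ sumTo-cong (suc n) (λ i i≤ → split-weight i≤) ⟩
  sumTo (suc n) (λ i → fromℕ i * t i + fromℕ (suc n ∸ i) * t i)
    ≡⟨ sumTo-+ (suc n) _ _ ⟩
  sumTo (suc n) (λ i → fromℕ i * t i) + sumTo (suc n) (λ i → fromℕ (suc n ∸ i) * t i)
    ≡⟨ cong₂ _+_ derivative-left derivative-right ⟩
  mulS (DS f) g n + mulS f (DS g) n ∎
  where
  open ≡-Reasoning
  t : ℕ → ℚ
  t i = f i * g (suc n ∸ i)
  -- n + 1 = i + (n + 1 - i) distributes the weight between the two factors
  split-weight : ∀ {i} → i ≤ suc n → fromℕ (suc n) * t i ≡ fromℕ i * t i + fromℕ (suc n ∸ i) * t i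
  split-weight {i} i≤ = trans (cong (_* t i) (trans (cong fromℕ (sym (ℕP.m+[n∸m]≡n i≤))) (fromℕ-+ i (suc n ∸ i))))
    (ℚP.*-distribʳ-+ (t i) (fromℕ i) (fromℕ (suc n ∸ i)))
  commute : ∀ (a b c : ℚ) → a * (b * c) ≡ b * (a * c)
  commute = solve-∀ ℚ-ring
  derivative-left : sumTo (suc n) (λ i → fromℕ i * t i) ≡ mulS (DS f) g n
  derivative-left = begin
    sumTo (suc n) (λ i → fromℕ i * t i)                    ≡⟨ sumTo-shift n (λ i → fromℕ i * t i) ⟩
    0ℚ * t 0 + sumTo n (λ i → fromℕ (suc i) * t (suc i))   ≡⟨ cong₂ _+_ (ℚP.*-zeroˡ (t 0))
        (sumTo-cong′ n (λ i → sym (ℚP.*-assoc (fromℕ (suc i)) (f (suc i)) (g (n ∸ i))))) ⟩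
    0ℚ + mulS (DS f) g n                                   ≡⟨ ℚP.+-identityˡ _ ⟩
    mulS (DS f) g n                                        ∎
  derivative-right : sumTo (suc n) (λ i → fromℕ (suc n ∸ i) * t i) ≡ mulS f (DS g) n
  derivative-right = begin
    sumTo n (λ i → fromℕ (suc n ∸ i) * t i) + fromℕ (n ∸ n) * t (suc n)
      ≡⟨ cong (λ z → sumTo n (λ i → fromℕ (suc n ∸ i) * t i) + fromℕ z * t (suc n)) (ℕP.n∸n≡0 n) ⟩
    sumTo n (λ i → fromℕ (suc n ∸ i) * t i) + 0ℚ * t (suc n)
      ≡⟨ cong (λ z → sumTo n (λ i → fromℕ (suc n ∸ i) * t i) + z) (ℚP.*-zeroˡ (t (suc n))) ⟩
    sumTo n (λ i → fromℕ (suc n ∸ i) * t i) + 0ℚ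
      ≡⟨ ℚP.+-identityʳ _ ⟩
    sumTo n (λ i → fromℕ (suc n ∸ i) * t i)
      ≡⟨ sumTo-cong n term ⟩
    mulS f (DS g) n ∎
    where
    term : ∀ i → i ≤ n → fromℕ (suc n ∸ i) * t i ≡ f i * DS g (n ∸ i)
    term i i≤n rewrite ℕP.+-∸-assoc 1 i≤n = commute (fromℕ (suc (n ∸ i))) (f i) (g (suc (n ∸ i)))

DS-powS : ∀ f m → DS (powS f (suc m)) ≈ scaleS (fromℕ (suc m)) (mulS (powS f m) (DS f))
DS-powS f zero    = ≈-trans (DS-cong (mulS-oneʳ f)) (λ n → sym (trans (ℚP.*-identityˡ _) (mulS-oneˡ (DS f) n)))
DS-powS f (suc m) = begin
  DS (mulS f X)                                         ≈⟨ DS-leibniz f X ⟩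
  addS (mulS (DS f) X) (mulS f (DS X))                  ≈⟨ addS-cong (mulS-comm (DS f) X)
                                                                     (mulS-cong (≈-refl {f}) (DS-powS f m)) ⟩
  addS Y (mulS f (scaleS c Z))                          ≈⟨ addS-cong (≈-refl {Y}) (mulS-scaleʳ c f Z) ⟩
  addS Y (scaleS c (mulS f Z))                         ≈⟨ addS-cong (≈-refl {Y})
                                                             (scaleS-cong c (mulS-assoc f (powS f m) (DS f))) ⟨
  addS Y (scaleS c Y)                                   ≈⟨ (λ n → collect c (Y n)) ⟩
  scaleS (1ℚ + c) Y                                     ≈⟨ (λ n → cong (_* Y n) (sym (fromℕ-+ 1 (suc m)))) ⟩
  scaleS (fromℕ (suc (suc m))) Y                        ∎
  where
  open SetoidReasoning ≈-setoid
  X Y Z : FPS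
  X = powS f (suc m)
  Y = mulS X (DS f)
  Z = mulS (powS f m) (DS f)
  c : ℚ
  c = fromℕ (suc m)
  collect : ∀ (c z : ℚ) → z + c * z ≡ (1ℚ + c) * z
  collect = solve-∀ ℚ-ring

coeff-addP : ∀ p q m → coeff (addP p q) m ≡ coeff p m ℤ.+ coeff q m
coeff-addP []      q       m       = sym (ℤP.+-identityˡ (coeff q m))
coeff-addP (a ∷ p) []      m       = sym (ℤP.+-identityʳ (coeff (a ∷ p) m))
coeff-addP (a ∷ p) (b ∷ q) zero    = refl
coeff-addP (a ∷ p) (b ∷ q) (suc m) = coeff-addP p q m

coeff-scaleP : ∀ c p m → coeff (scaleP c p) m ≡ c ℤ.* coeff p m
coeff-scaleP c []      m       = sym (ℤP.*-zeroʳ c)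
coeff-scaleP c (a ∷ p) zero    = refl
coeff-scaleP c (a ∷ p) (suc m) = coeff-scaleP c p m

S1-rec-zero : ∀ n → S1 (suc n) 0 ≡ ℤ.- (+ n) ℤ.* S1 n 0
S1-rec-zero n = trans (coeff-addP (shiftP (fallingPoly n)) (scaleP (ℤ.- (+ n)) (fallingPoly n)) 0)
  (trans (ℤP.+-identityˡ _) (coeff-scaleP (ℤ.- (+ n)) (fallingPoly n) 0))

S1-rec-suc : ∀ n m → S1 (suc n) (suc m) ≡ S1 n m ℤ.+ ℤ.- (+ n) ℤ.* S1 n (suc m)
S1-rec-suc n m = trans (coeff-addP (shiftP (fallingPoly n)) (scaleP (ℤ.- (+ n)) (fallingPoly n)) (suc m))
  (cong (λ z → S1 n m ℤ.+ z) (coeff-scaleP (ℤ.- (+ n)) (fallingPoly n) (suc m)))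

S1-above : ∀ n m → n < m → S1 n m ≡ + 0
S1-above zero    (suc m) _         = refl
S1-above (suc n) (suc m) (s≤s n<m) = trans (S1-rec-suc n m)
  (cong₂ ℤ._+_ (S1-above n m n<m)
    (trans (cong (ℤ.- (+ n) ℤ.*_) (S1-above n (suc m) (ℕP.m<n⇒m<1+n n<m))) (ℤP.*-zeroʳ (ℤ.- (+ n)))))

S1-suc-zero : ∀ n → S1 (suc n) 0 ≡ + 0
S1-suc-zero zero    = refl
S1-suc-zero (suc n) = trans (S1-rec-zero (suc n))
  (trans (cong (ℤ.- (+ suc n) ℤ.*_) (S1-suc-zero n)) (ℤP.*-zeroʳ (ℤ.- (+ suc n))))

s1 : ℕ → ℕ → ℚ
s1 n m = fromℤ (S1 n m)

s1-rec-zero : ∀ n → s1 (suc n) 0 ≡ - fromℕ n * s1 n 0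
s1-rec-zero n = trans (cong fromℤ (S1-rec-zero n))
  (trans (fromℤ-* (ℤ.- (+ n)) (S1 n 0)) (cong (_* s1 n 0) (fromℤ-neg (+ n))))

s1-rec-suc : ∀ n m → s1 (suc n) (suc m) ≡ s1 n m + - fromℕ n * s1 n (suc m)
s1-rec-suc n m = trans (cong fromℤ (S1-rec-suc n m))
  (trans (fromℤ-+ (S1 n m) _)
    (cong (λ z → s1 n m + z) (trans (fromℤ-* (ℤ.- (+ n)) (S1 n (suc m))) (cong (_* s1 n (suc m)) (fromℤ-neg (+ n))))))

falling-expansion : ∀ x n → sumTo n (λ m → s1 n m * powQ x m) ≡ fallingQ x n
falling-expansion x zero    = refl
falling-expansion x (suc n) = begin
  sumTo (suc n) (λ m → s1 (suc n) m * powQ x m)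
    ≡⟨ sumTo-cong′ (suc n) term ⟩
  sumTo (suc n) (λ m → x * shifted m - fromℕ n * (s1 n m * powQ x m))
    ≡⟨ sumTo-- (suc n) _ _ ⟩
  sumTo (suc n) (λ m → x * shifted m) - sumTo (suc n) (λ m → fromℕ n * (s1 n m * powQ x m))
    ≡⟨ cong₂ _-_ (trans (sym (sumTo-*ˡ (suc n) x shifted)) (cong (x *_) shifted-sum))
                 (trans (sym (sumTo-*ˡ (suc n) (fromℕ n) _)) (cong (fromℕ n *_) top-term-vanishes)) ⟩
  x * F - fromℕ n * F
    ≡⟨ factor x (fromℕ n) F ⟩
  F * (x - fromℕ n)
    ≡⟨ cong (_* (x - fromℕ n)) (falling-expansion x n) ⟩
  fallingQ x (suc n) ∎
  where
  open ≡-Reasoning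
  F : ℚ
  F = sumTo n (λ m → s1 n m * powQ x m)
  shifted : ℕ → ℚ
  shifted zero    = 0ℚ
  shifted (suc m) = s1 n m * powQ x m
  shifted-sum : sumTo (suc n) shifted ≡ F
  shifted-sum = trans (sumTo-shift n shifted) (ℚP.+-identityˡ F)
  top-term-vanishes : sumTo (suc n) (λ m → s1 n m * powQ x m) ≡ F
  top-term-vanishes = sumTo-extend (ℕP.n≤1+n n) (λ i n<i →
    trans (cong (λ z → fromℤ z * powQ x i) (S1-above n i n<i)) (ℚP.*-zeroˡ (powQ x i)))
  factor : ∀ x N F → x * F - N * F ≡ F * (x - N)
  factor = solve-∀ ℚ-ring
  term-zero : ∀ N a x → - N * a * 1ℚ ≡ x * 0ℚ - N * (a * 1ℚ)
  term-zero = solve-∀ ℚ-ring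
  term-suc : ∀ a N b x p → (a + - N * b) * (x * p) ≡ x * (a * p) - N * (b * (x * p))
  term-suc = solve-∀ ℚ-ring
  term : ∀ m → s1 (suc n) m * powQ x m ≡ x * shifted m - fromℕ n * (s1 n m * powQ x m)
  term zero    = trans (cong (_* 1ℚ) (s1-rec-zero n)) (term-zero (fromℕ n) (s1 n 0) x)
  term (suc m) = trans (cong (_* powQ x (suc m)) (s1-rec-suc n m))
                       (term-suc (s1 n m) (fromℕ n) (s1 n (suc m)) x (powQ x m))

-- Powers of L = log(1+t):  L^m = m! Σ_n S1(n,m) t^n/n!.  With
-- Λ_m = Σ_n S1(n,m) t^n/n!, both sides are compared through their
-- derivatives: (1+t) DL = 1 and (1+t) DΛ_{m+1} = Λ_m (the Stirling
-- recurrence), so DΛ_{m+1} = Λ_m DL, matching D(L^{m+1}) = (m+1) L^m DL.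

stirlingColumn : ℕ → FPS
stirlingColumn m n = s1 n m * invFact n

DS-logS : ∀ n → DS logS n ≡ powQ (- 1ℚ) n
DS-logS n = trans (commute (fromℕ (suc n)) (powQ (- 1ℚ) n) _)
  (trans (cong (powQ (- 1ℚ) n *_) (fromℕ-inverse (suc n))) (ℚP.*-identityʳ _))
  where
  commute : ∀ (a b c : ℚ) → a * (b * c) ≡ b * (a * c)
  commute = solve-∀ ℚ-ring

onePlusT-DS-logS : mulS onePlusT (DS logS) ≈ oneS
onePlusT-DS-logS zero    = trans (mulS-onePlusT-zero (DS logS)) (DS-logS 0)
onePlusT-DS-logS (suc n) = trans (mulS-onePlusT-suc (DS logS) n)
  (trans (cong₂ _+_ (DS-logS (suc n)) (DS-logS n)) (cancel (powQ (- 1ℚ) n)))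
  where
  cancel : ∀ p → (- 1ℚ) * p + p ≡ 0ℚ
  cancel = solve-∀ ℚ-ring

DS-column : ∀ m n → DS (stirlingColumn (suc m)) n ≡ s1 (suc n) (suc m) * invFact n
DS-column m n = trans (commute (fromℕ (suc n)) (s1 (suc n) (suc m)) (invFact (suc n)))
  (cong (s1 (suc n) (suc m) *_) (invFact-suc n))
  where
  commute : ∀ (a b c : ℚ) → a * (b * c) ≡ b * (a * c)
  commute = solve-∀ ℚ-ring

onePlusT-DS-column : ∀ m → mulS onePlusT (DS (stirlingColumn (suc m))) ≈ stirlingColumn m
onePlusT-DS-column m zero = trans (mulS-onePlusT-zero (DS Λ′)) (trans (DS-column m 0)
  (cong (_* invFact 0) (trans (s1-rec-suc 0 m) (drop (s1 0 m) (s1 0 (suc m))))))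
  where
  Λ′ : FPS
  Λ′ = stirlingColumn (suc m)
  drop : ∀ a b → a + - 0ℚ * b ≡ a
  drop = solve-∀ ℚ-ring
onePlusT-DS-column m (suc n) = begin
  mulS onePlusT (DS Λ′) (suc n)
    ≡⟨ mulS-onePlusT-suc (DS Λ′) n ⟩
  DS Λ′ (suc n) + DS Λ′ n
    ≡⟨ cong₂ _+_ (DS-column m (suc n)) (DS-column m n) ⟩
  s1 (suc (suc n)) (suc m) * invFact (suc n) + s1 (suc n) (suc m) * invFact n
    ≡⟨ cong₂ _+_ (cong (_* invFact (suc n)) (s1-rec-suc (suc n) m))
                 (cong (s1 (suc n) (suc m) *_) (sym (invFact-suc n))) ⟩
  (s1 (suc n) m + - N * s1 (suc n) (suc m)) * invFact (suc n) + s1 (suc n) (suc m) * (N * invFact (suc n))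
    ≡⟨ recurrence (s1 (suc n) m) N (s1 (suc n) (suc m)) (invFact (suc n)) ⟩
  stirlingColumn m (suc n) ∎
  where
  open ≡-Reasoning
  Λ′ : FPS
  Λ′ = stirlingColumn (suc m)
  N : ℚ
  N = fromℕ (suc n)
  recurrence : ∀ a N b I → (a + - N * b) * I + b * (N * I) ≡ a * I
  recurrence = solve-∀ ℚ-ring

DS-column-eq : ∀ m → DS (stirlingColumn (suc m)) ≈ mulS (stirlingColumn m) (DS logS)
DS-column-eq m = begin
  D                                       ≈⟨ mulS-oneʳ D ⟨
  mulS D oneS                             ≈⟨ mulS-cong (≈-refl {D}) onePlusT-DS-logS ⟨
  mulS D (mulS onePlusT (DS logS))        ≈⟨ mulS-assoc D onePlusT (DS logS) ⟨
  mulS (mulS D onePlusT) (DS logS)        ≈⟨ mulS-cong (≈-trans (mulS-comm D onePlusT) (onePlusT-DS-column m))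
                                                       (≈-refl {DS logS}) ⟩
  mulS (stirlingColumn m) (DS logS)       ∎
  where
  open SetoidReasoning ≈-setoid
  D : FPS
  D = DS (stirlingColumn (suc m))

logS-powS : ∀ m → powS logS m ≈ scaleS (fromℕ (m !)) (stirlingColumn m)
logS-powS zero zero    = refl
logS-powS zero (suc n) = sym (trans (ℚP.*-identityˡ _)
  (trans (cong (λ z → fromℤ z * invFact (suc n)) (S1-suc-zero n)) (ℚP.*-zeroˡ (invFact (suc n)))))
logS-powS (suc m) = DS-unique derivatives constant-terms
  where
  open SetoidReasoning ≈-setoid
  c : ℚ
  c = fromℕ (suc m)
  Λ Λ′ : FPS
  Λ  = stirlingColumn m
  Λ′ = stirlingColumn (suc m)
  constant-terms : powS logS (suc m) 0 ≡ fromℕ (suc m !) * (s1 0 (suc m) * invFact 0)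
  constant-terms = trans (ℚP.*-zeroˡ (powS logS m 0))
    (sym (trans (cong (fromℕ (suc m !) *_) (ℚP.*-zeroˡ (invFact 0))) (ℚP.*-zeroʳ (fromℕ (suc m !)))))
  derivatives : DS (powS logS (suc m)) ≈ DS (scaleS (fromℕ (suc m !)) (stirlingColumn (suc m)))
  derivatives = begin
    DS (powS logS (suc m))                               ≈⟨ DS-powS logS m ⟩
    scaleS c (mulS (powS logS m) (DS logS))              ≈⟨ scaleS-cong c (mulS-cong (logS-powS m) (≈-refl {DS logS})) ⟩
    scaleS c (mulS (scaleS (fromℕ (m !)) Λ) (DS logS))   ≈⟨ scaleS-cong c (mulS-scaleˡ (fromℕ (m !)) Λ (DS logS)) ⟩
    scaleS c (scaleS (fromℕ (m !)) (mulS Λ (DS logS)))   ≈⟨ scaleS-scaleS c (fromℕ (m !)) _ ⟩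
    scaleS (c * fromℕ (m !)) (mulS Λ (DS logS))          ≈⟨ (λ n → cong (_* mulS Λ (DS logS) n) (sym (fromℕ-* (suc m) (m !)))) ⟩
    scaleS (fromℕ (suc m !)) (mulS Λ (DS logS))          ≈⟨ scaleS-cong (fromℕ (suc m !)) (DS-column-eq m) ⟨
    scaleS (fromℕ (suc m !)) (DS Λ′)                     ≈⟨ DS-scale (fromℕ (suc m !)) Λ′ ⟨
    DS (scaleS (fromℕ (suc m !)) Λ′)                     ∎

-- e^{xL} = (1+t)^x:  the coefficient of t^n on the left is
-- Σ_m x^m/m! · m! S1(n,m)/n! = x(x-1)⋯(x-n+1)/n!.
expS-logS : ∀ x → composeS (expS x) logS ≈ binomS x
expS-logS x n = begin
  sumTo n (λ m → (powQ x m * invFact m) * powS logS m n)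
    ≡⟨ sumTo-cong′ n (λ m → trans (cong ((powQ x m * invFact m) *_) (logS-powS m n))
                                  (cancel-factorial (powQ x m) (invFact m) (fromℕ (m !)) (s1 n m) (invFact n) (fromℕ-fact m))) ⟩
  sumTo n (λ m → s1 n m * powQ x m * invFact n)
    ≡⟨ sumTo-*ʳ n (invFact n) _ ⟨
  sumTo n (λ m → s1 n m * powQ x m) * invFact n
    ≡⟨ cong (_* invFact n) (falling-expansion x n) ⟩
  binomS x n ∎
  where
  open ≡-Reasoning
  regroup : ∀ p i F s I → (p * i) * (F * (s * I)) ≡ (F * i) * (s * p * I)
  regroup = solve-∀ ℚ-ring
  cancel-factorial : ∀ p i F s I → F * i ≡ 1ℚ → (p * i) * (F * (s * I)) ≡ s * p * I
  cancel-factorial p i F s I F*i≡1 =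
    trans (regroup p i F s I) (trans (cong (_* (s * p * I)) F*i≡1) (ℚP.*-identityˡ _))

-- For a natural number s the binomial series is (1+t)^s, by Pascal's rule
-- (1+t) (1+t)^x = (1+t)^{x+1}.

binomS-zero : binomS 0ℚ ≈ oneS
binomS-zero zero    = refl
binomS-zero (suc n) = trans (cong (_* invFact (suc n)) (fallingQ-zero n)) (ℚP.*-zeroˡ (invFact (suc n)))
  where
  fallingQ-zero : ∀ n → fallingQ 0ℚ (suc n) ≡ 0ℚ
  fallingQ-zero zero    = refl
  fallingQ-zero (suc n) = trans (cong (_* (0ℚ - fromℕ (suc n))) (fallingQ-zero n)) (ℚP.*-zeroˡ (0ℚ - fromℕ (suc n)))

pascal : ∀ x → mulS onePlusT (binomS x) ≈ binomS (1ℚ + x)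
pascal x zero    = mulS-onePlusT-zero (binomS x)
pascal x (suc n) = begin
  mulS onePlusT (binomS x) (suc n)
    ≡⟨ mulS-onePlusT-suc (binomS x) n ⟩
  fallingQ x n * (x - fromℕ n) * invFact (suc n) + fallingQ x n * invFact n
    ≡⟨ cong (λ z → fallingQ x n * (x - fromℕ n) * invFact (suc n) + fallingQ x n * z)
            (trans (sym (invFact-suc n)) (cong (_* invFact (suc n)) (fromℕ-+ 1 n))) ⟩
  fallingQ x n * (x - fromℕ n) * invFact (suc n) + fallingQ x n * ((1ℚ + fromℕ n) * invFact (suc n))
    ≡⟨ combine x (fallingQ x n) (fromℕ n) (invFact (suc n)) ⟩
  ((1ℚ + x) * fallingQ x n) * invFact (suc n)
    ≡⟨ cong (_* invFact (suc n)) (fallingQ-shift x n) ⟨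
  binomS (1ℚ + x) (suc n) ∎
  where
  open ≡-Reasoning
  combine : ∀ x F N I → F * (x - N) * I + F * ((1ℚ + N) * I) ≡ ((1ℚ + x) * F) * I
  combine = solve-∀ ℚ-ring
  fallingQ-shift : ∀ x n → fallingQ (1ℚ + x) (suc n) ≡ (1ℚ + x) * fallingQ x n
  fallingQ-shift x zero    = base x
    where
    base : ∀ x → 1ℚ * ((1ℚ + x) - 0ℚ) ≡ (1ℚ + x) * 1ℚ
    base = solve-∀ ℚ-ring
  fallingQ-shift x (suc n) = trans (cong₂ _*_ (fallingQ-shift x n) (cong (λ z → (1ℚ + x) - z) (fromℕ-+ 1 n)))
    (step x (fallingQ x n) (fromℕ n))
    where
    step : ∀ x F N → ((1ℚ + x) * F) * ((1ℚ + x) - (1ℚ + N)) ≡ (1ℚ + x) * (F * (x - N))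
    step = solve-∀ ℚ-ring

binomS-fromℕ : ∀ s → binomS (fromℕ s) ≈ powS onePlusT s
binomS-fromℕ zero    = binomS-zero
binomS-fromℕ (suc s) = begin
  binomS (fromℕ (suc s))               ≈⟨ (λ n → cong (λ z → binomS z n) (fromℕ-+ 1 s)) ⟩
  binomS (1ℚ + fromℕ s)                ≈⟨ pascal (fromℕ s) ⟨
  mulS onePlusT (binomS (fromℕ s))     ≈⟨ mulS-cong (≈-refl {onePlusT}) (binomS-fromℕ s) ⟩
  powS onePlusT (suc s)                ∎
  where open SetoidReasoning ≈-setoid

-- Substituting L into the Bernoulli factor:  (t/(e^t-1))∘L = L/t.  Indeed
-- L · ((e^t-1)/t)∘L = (e^t-1)∘L = (1+t) - 1 = t, so ((e^t-1)/t)∘L is inverse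
-- to L/t, and it is also inverse to (t/(e^t-1))∘L.

logS≈t·logOverT : logS ≈ mulS tS logOverT
logS≈t·logOverT zero    = sym (mulS-t-zero logOverT)
logS≈t·logOverT (suc n) = sym (mulS-t-suc logOverT n)

t·expm1OverT : mulS tS expm1OverT ≈ subS (expS 1ℚ) oneS
t·expm1OverT zero    = mulS-t-zero expm1OverT
t·expm1OverT (suc n) = trans (mulS-t-suc expm1OverT n)
  (sym (trans (ℚP.+-identityʳ _) (trans (cong (_* invFact (suc n)) (powQ-one (suc n))) (ℚP.*-identityˡ _))))
  where
  powQ-one : ∀ k → powQ 1ℚ k ≡ 1ℚ
  powQ-one zero    = refl
  powQ-one (suc k) = trans (ℚP.*-identityˡ _) (powQ-one k)

logOverT·expm1∘log : mulS logOverT (composeS expm1OverT logS) ≈ oneS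
logOverT·expm1∘log = mulS-t-cancel (begin
  mulS tS (mulS logOverT E)                    ≈⟨ mulS-assoc tS logOverT E ⟨
  mulS (mulS tS logOverT) E                    ≈⟨ mulS-cong logS≈t·logOverT (≈-refl {E}) ⟨
  mulS logS E                                  ≈⟨ mulS-cong (composeS-tS logS refl) (≈-refl {E}) ⟨
  mulS (composeS tS logS) E                    ≈⟨ composeS-mulS tS expm1OverT logS refl ⟨
  composeS (mulS tS expm1OverT) logS           ≈⟨ composeS-congˡ logS t·expm1OverT ⟩
  composeS (subS (expS 1ℚ) oneS) logS          ≈⟨ composeS-sub (expS 1ℚ) oneS logS ⟩
  subS (composeS (expS 1ℚ) logS) (composeS oneS logS)
                                               ≈⟨ (λ n → cong₂ _-_ (expS-logS 1ℚ n) (composeS-oneS logS n)) ⟩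
  subS (binomS 1ℚ) oneS                        ≈⟨ (λ n → cong (_- oneS n) (binomS-fromℕ 1 n)) ⟩
  subS (powS onePlusT 1) oneS                  ≈⟨ (λ n → cong (_- oneS n) (mulS-oneʳ onePlusT n)) ⟩
  subS onePlusT oneS                           ≈⟨ onePlusT-minus-one ⟩
  tS                                           ≈⟨ mulS-oneʳ tS ⟨
  mulS tS oneS                                 ∎)
  where
  open SetoidReasoning ≈-setoid
  E : FPS
  E = composeS expm1OverT logS
  onePlusT-minus-one : subS onePlusT oneS ≈ tS
  onePlusT-minus-one zero          = refl
  onePlusT-minus-one (suc zero)    = refl
  onePlusT-minus-one (suc (suc n)) = refl

bernoulliFactor∘log : composeS (recipS expm1OverT) logS ≈ logOverT
bernoulliFactor∘log = inverse-unique FPS-monoid E _ _ E·β∘L E·logOverT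
  where
  E : FPS
  E = composeS expm1OverT logS
  E·β∘L : mulS E (composeS (recipS expm1OverT) logS) ≈ oneS
  E·β∘L = ≈-trans (≈-sym (composeS-mulS expm1OverT (recipS expm1OverT) logS refl))
    (≈-trans (composeS-congˡ logS (recipS-inverse expm1OverT refl)) (composeS-oneS logS))
  E·logOverT : mulS E logOverT ≈ oneS
  E·logOverT = ≈-trans (mulS-comm E logOverT) logOverT·expm1∘log

atildeSeries : ℕ → ℤ → ℚ → FPS
atildeSeries r k x = mulS (mulS (powS baseA r) (lifS k)) (binomS x)

bernoulliSeries : ℕ → ℚ → FPS
bernoulliSeries s x = mulS (powS (recipS expm1OverT) s) (expS x)

bernoulliSeries∘log : ∀ s x → composeS (bernoulliSeries s x) logS ≈ mulS (powS logOverT s) (binomS x)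
bernoulliSeries∘log s x = ≈-trans (composeS-mulS (powS (recipS expm1OverT) s) (expS x) logS refl)
  (mulS-cong (≈-trans (composeS-powS (recipS expm1OverT) logS refl s) (powS-cong bernoulliFactor∘log s))
             (expS-logS x))

-- After expanding
-- A_{r+s,s} = W^r W^s Lif (1+t)^s with W = t/((1+t)L) and substituting,
-- the factors W^s (1+t)^s (L/t)^s = (W (1+t) L/t)^s = 1 cancel.
series-identity : ∀ r s k x →
  mulS (atildeSeries (r ℕ.+ s) k (fromℕ s)) (composeS (bernoulliSeries s x) logS) ≈ atildeSeries r k x
series-identity r s k x = begin
  mulS (atildeSeries (r ℕ.+ s) k (fromℕ s)) (composeS (bernoulliSeries s x) logS)
    ≈⟨ mulS-cong (mulS-cong (mulS-cong (powS-+ baseA r s) (≈-refl {lifS k})) (binomS-fromℕ s))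
                 (bernoulliSeries∘log s x) ⟩
  mulS (mulS (mulS (mulS Wʳ Wˢ) (lifS k)) Oˢ) (mulS Lˢ (binomS x))
    ≈⟨ regroup Wʳ Wˢ (lifS k) Oˢ Lˢ (binomS x) ⟩
  mulS (atildeSeries r k x) (mulS Wˢ (mulS Oˢ Lˢ))
    ≈⟨ mulS-cong (≈-refl {atildeSeries r k x}) cancelling-factors ⟩
  mulS (atildeSeries r k x) oneS
    ≈⟨ mulS-oneʳ (atildeSeries r k x) ⟩
  atildeSeries r k x ∎
  where
  open SetoidReasoning ≈-setoid
  Wʳ Wˢ Oˢ Lˢ : FPS
  Wʳ = powS baseA r
  Wˢ = powS baseA s
  Oˢ = powS onePlusT s
  Lˢ = powS logOverT s
  regroup : ∀ a b c d e f → mulS (mulS (mulS (mulS a b) c) d) (mulS e f) ≈ mulS (mulS (mulS a c) f) (mulS b (mulS d e))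
  regroup a b c d e f =
    prove 6 ((((A ⊕ B) ⊕ C) ⊕ D) ⊕ (E ⊕ F)) (((A ⊕ C) ⊕ F) ⊕ (B ⊕ (D ⊕ E))) (a ∷ b ∷ c ∷ d ∷ e ∷ f ∷ [])
    where
    open CommutativeMonoidSolver FPS-monoid using (prove; var; _⊕_)
    A = var Fin.zero
    B = var (Fin.suc Fin.zero)
    C = var (Fin.suc (Fin.suc Fin.zero))
    D = var (Fin.suc (Fin.suc (Fin.suc Fin.zero)))
    E = var (Fin.suc (Fin.suc (Fin.suc (Fin.suc Fin.zero))))
    F = var (Fin.suc (Fin.suc (Fin.suc (Fin.suc (Fin.suc Fin.zero)))))
  -- W (1+t) (L/t) = 1 because W is defined as the reciprocal of (1+t) (L/t)
  cancelling-factors : mulS Wˢ (mulS Oˢ Lˢ) ≈ oneS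
  cancelling-factors = begin
    mulS Wˢ (mulS Oˢ Lˢ)                          ≈⟨ mulS-cong (≈-refl {Wˢ}) (powS-mulS onePlusT logOverT s) ⟨
    mulS Wˢ (powS (mulS onePlusT logOverT) s)     ≈⟨ powS-mulS baseA (mulS onePlusT logOverT) s ⟨
    powS (mulS baseA (mulS onePlusT logOverT)) s  ≈⟨ powS-cong W·O·L s ⟩
    powS oneS s                                   ≈⟨ powS-oneS s ⟩
    oneS                                          ∎
    where
    W·O·L : mulS baseA (mulS onePlusT logOverT) ≈ oneS
    W·O·L = ≈-trans (mulS-comm baseA (mulS onePlusT logOverT)) (recipS-inverse (mulS onePlusT logOverT) refl)

-- Coefficient extraction: for arbitrary series Q and c,
--   n! [t^n] Q(t) c(L(t)) = Σ_m Σ_{l ≤ n-m} C(n,l) S1(n-l,m) (l! Q_l) (m! c_m),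
-- obtained by expanding L^m with Stirling numbers, exchanging the two sums,
-- and using C(n,l) l! = n!/(n-l)!.
coefficient-formula : ∀ (Q c : FPS) n →
  fromℕ (n !) * mulS Q (composeS c logS) n ≡
  sumTo n (λ m → sumTo (n ∸ m) (λ l → fromℕ (n C l) * s1 (n ∸ l) m * (fromℕ (l !) * Q l)) * (fromℕ (m !) * c m))
coefficient-formula Q c n = sym (begin
  sumTo n (λ m → sumTo (n ∸ m) (λ l → fromℕ (n C l) * s1 (n ∸ l) m * (fromℕ (l !) * Q l)) * (fromℕ (m !) * c m))
    ≡⟨ sumTo-cong′ n (λ m → sumTo-*ʳ (n ∸ m) (fromℕ (m !) * c m) _) ⟩
  sumTo n (λ m → sumTo (n ∸ m) (λ l → term m l))
    ≡⟨ sumTo-triangle-swap n term ⟩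
  sumTo n (λ l → sumTo (n ∸ l) (λ m → term m l))
    ≡⟨ sumTo-cong n (λ l l≤n → sumTo-cong′ (n ∸ l) (λ m → term-as-coefficient l≤n m)) ⟩
  sumTo n (λ l → sumTo (n ∸ l) (λ m → N * (Q l * (c m * powS logS m (n ∸ l)))))
    ≡⟨ sumTo-cong′ n (λ l → trans (sym (sumTo-*ˡ (n ∸ l) N _)) (cong (N *_) (sym (sumTo-*ˡ (n ∸ l) (Q l) _)))) ⟩
  sumTo n (λ l → N * (Q l * composeS c logS (n ∸ l)))
    ≡⟨ sumTo-*ˡ n N _ ⟨
  N * mulS Q (composeS c logS) n ∎)
  where
  open ≡-Reasoning
  N : ℚ
  N = fromℕ (n !)
  term : ℕ → ℕ → ℚ
  term m l = fromℕ (n C l) * s1 (n ∸ l) m * (fromℕ (l !) * Q l) * (fromℕ (m !) * c m)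
  regroup : ∀ B s L q M c → B * s * (L * q) * (M * c) ≡ (B * L) * (s * q * M * c)
  regroup = solve-∀ ℚ-ring
  regroup′ : ∀ N I s q M c → (N * I) * (s * q * M * c) ≡ N * (q * (c * (M * (s * I))))
  regroup′ = solve-∀ ℚ-ring
  term-as-coefficient : ∀ {l} → l ≤ n → ∀ m → term m l ≡ N * (Q l * (c m * powS logS m (n ∸ l)))
  term-as-coefficient {l} l≤n m = begin
    term m l
      ≡⟨ regroup (fromℕ (n C l)) (s1 (n ∸ l) m) (fromℕ (l !)) (Q l) (fromℕ (m !)) (c m) ⟩
    (fromℕ (n C l) * fromℕ (l !)) * (s1 (n ∸ l) m * Q l * fromℕ (m !) * c m)
      ≡⟨ cong (_* (s1 (n ∸ l) m * Q l * fromℕ (m !) * c m)) (binomial-factorial n l l≤n) ⟩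
    (N * invFact (n ∸ l)) * (s1 (n ∸ l) m * Q l * fromℕ (m !) * c m)
      ≡⟨ regroup′ N (invFact (n ∸ l)) (s1 (n ∸ l) m) (Q l) (fromℕ (m !)) (c m) ⟩
    N * (Q l * (c m * (fromℕ (m !) * (s1 (n ∸ l) m * invFact (n ∸ l)))))
      ≡⟨ cong (λ z → N * (Q l * (c m * z))) (logS-powS m (n ∸ l)) ⟨
    N * (Q l * (c m * powS logS m (n ∸ l))) ∎

-- Theorem 7.
theorem7 : (r s : ℕ) → 1 ≤ r → 1 ≤ s → (k : ℤ) → (n : ℕ) → (x : ℚ) →
    Atilde r k n x ≡
      sumTo n (λ m →
        sumTo (n ∸ m) (λ l →
          fromℕ (n C l) * fromℤ (S1 (n ∸ l) m) * Atilde (r ℕ.+ s) k l (fromℕ s))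
        * bernoulli s m x)
theorem7 r s _ _ k n x = begin
  fromℕ (n !) * atildeSeries r k x n
    ≡⟨ cong (fromℕ (n !) *_) (series-identity r s k x n) ⟨
  fromℕ (n !) * mulS (atildeSeries (r ℕ.+ s) k (fromℕ s)) (composeS (bernoulliSeries s x) logS) n
    ≡⟨ coefficient-formula (atildeSeries (r ℕ.+ s) k (fromℕ s)) (bernoulliSeries s x) n ⟩
  sumTo n (λ m →
    sumTo (n ∸ m) (λ l → fromℕ (n C l) * s1 (n ∸ l) m * Atilde (r ℕ.+ s) k l (fromℕ s))
    * bernoulli s m x) ∎
  where open ≡-Reasoning
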